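{- Let $\mathfrak{g}$ be of type $E_6^{(1)}$ and $s\ge1$. Let $\alpha = \alpha_2 + \alpha_3 + 2\alpha_4 + 2\alpha_5 + \alpha_6 = \Lambda_5-\Lambda_1$. Then the highest weight rigged configurations of $B^{5,s}$ are exactly $\nu(k\ast[\alpha])$, $0\le k\le s$, with all riggings $0$; the one indexed by $k$ has weight $(s-k)\Lambda_5+k\Lambda_1$ and cocharge $k$. Consequently \[ \mathrm{RC}(B^{5,s}) = \bigoplus_{k=0}^s \mathrm{RC}(B^{5,s}; (s-k)\Lambda_5 + k\Lambda_1). \]
   Context: Finite type $E_6$ with Bourbaki labeling: edges $1$–$3$, $3$–$4$, $4$–$5$, $5$–$6$, $2$–$4$; $I_0=\{1,\dots,6\}$, Cartan matrix $(A_{ab})$, simple roots $\alpha_a$, fundamental weights $\Lambda_a$. Rigged configurations for $B^{r,s}$: a configuration $\nu=(\nu^{(a)})_{a\in I_0}$ is a tuple of partitions, $m_i^{(a)}$ the number of rows of length $i$ in $\nu^{(a)}$. Vacancy numbers: $p_i^{(a)} = \delta_{ar}\min(i,s) - \sum_{b\in I_0}A_{ab}\sum_{j\ge1}\min(i,j)m_j^{(b)}$. A rigged configuration $(\nu,J)$ assigns to each row of $\nu^{(a)}$ of length $i$ an integer rigging $x\le p_i^{(a)}$ (a multiset for rows of equal length); it is highest weight if all riggings are $\ge 0$. Weight: $s\Lambda_r-\sum_a|\nu^{(a)}|\alpha_a$. Cocharge: $\mathrm{cc}(\nu,J)=\frac12\sum_{a,b\in I_0}\sum_{i,j}A_{ab}\min(i,j)m_i^{(a)}m_j^{(b)}+\sum(\text{all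 riggings})$. $\mathrm{RC}(B^{r,s})$ is a $U_q(\mathfrak{g}_0)$-crystal whose highest weight elements are the highest weight rigged configurations, each of weight $\lambda$ generating a component isomorphic to $B(\lambda)$; $\mathrm{RC}(B^{r,s};\lambda)$ is the union of components with highest weight $\lambda$. For $\beta^{(k)}=\sum_a c_a^{(k)}\alpha_a$ with $c_a^{(k)}\in\mathbb{Z}_{\ge0}$, $\nu(\beta^{(1)},\dots,\beta^{(\ell)})$ is the configuration in which $\nu^{(a)}$ has columns of heights $c_a^{(1)},\dots,c_a^{(\ell)}$ (sorted, zeros omitted); $k\ast[\beta]$ is $k$ copies of $\beta$. -}

module Defs where

open import Data.Nat as ℕ using (ℕ; zero; suc; _⊓_)
open import Data.Nat.ListAction using (sum)
open import Data.Integer as ℤ using (ℤ; +_; _-_; _*_; _≤_)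
open import Data.Integer.DivMod using (_/ℕ_)
open import Data.Fin using (Fin; zero; suc)
open import Data.List using (List; []; _∷_; map; replicate; allFin; foldr)
open import Data.Product using (_×_; _,_; proj₁; proj₂)
open import Data.Sum using (_⊎_)
open import Data.Unit using (⊤)
open import Relation.Binary.PropositionalEquality using (_≡_)

sumℤ : List ℤ → ℤ
sumℤ = foldr ℤ._+_ (+ 0)

-- Nodes of E6 in Bourbaki labelling: node a ∈ {1,…,6} is the element of Fin 6 with toℕ = a - 1.
Node : Set
Node = Fin 6

n1 n2 n3 n4 n5 n6 : Node
n1 = zero
n2 = suc zero
n3 = suc (suc zero)
n4 = suc (suc (suc zero))
n5 = suc (suc (suc (suc zero)))
n6 = suc (suc (suc (suc (suc zero))))

-- adjacency: edges 1-3, 3-4, 4-5, 5-6, 2-4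
adj : Node → Node → ℕ
adj = go
  where
  go : Fin 6 → Fin 6 → ℕ
  go zero (suc (suc zero)) = 1
  go (suc (suc zero)) zero = 1
  go (suc (suc zero)) (suc (suc (suc zero))) = 1
  go (suc (suc (suc zero))) (suc (suc zero)) = 1
  go (suc (suc (suc zero))) (suc (suc (suc (suc zero)))) = 1
  go (suc (suc (suc (suc zero)))) (suc (suc (suc zero))) = 1
  go (suc (suc (suc (suc zero)))) (suc (suc (suc (suc (suc zero))))) = 1
  go (suc (suc (suc (suc (suc zero))))) (suc (suc (suc (suc zero)))) = 1
  go (suc zero) (suc (suc (suc zero))) = 1
  go (suc (suc (suc zero))) (suc zero) = 1
  go _ _ = 0

δ : ∀ {n} → Fin n → Fin n → ℕ
δ zero zero = 1
δ zero (suc _) = 0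
δ (suc _) zero = 0
δ (suc a) (suc b) = δ a b

cartan : Node → Node → ℤ
cartan a b = + (2 ℕ.* δ a b) - + adj a b

Σnode : (Node → ℤ) → ℤ
Σnode f = sumℤ (map f (allFin 6))

-- A row of a rigged partition: (length i, rigging x)
Row : Set
Row = ℕ × ℤ

-- A rigged partition is represented canonically as a list of rows sorted
-- weakly decreasing in the lexicographic order on (length, rigging);
-- this canonical form represents the multiset of riggings per row length.
RowGeq : Row → Row → Set
RowGeq (i , x) (j , y) = (j ℕ.< i) ⊎ ((i ≡ j) × (y ≤ x))

data Sorted : List Row → Set where
  []  : Sorted []
  [_] : ∀ r → Sorted (r ∷ [])
  _∷_ : ∀ {r r' rs} → RowGeq r r' → Sorted (r' ∷ rs) → Sorted (r ∷ r' ∷ rs)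

RiggedPartition : Set
RiggedPartition = List Row

RC : Set
RC = Node → RiggedPartition

Qmin : ℕ → RiggedPartition → ℕ
Qmin i rows = sum (map (λ r → i ⊓ proj₁ r) rows)

size : RiggedPartition → ℕ
size rows = sum (map proj₁ rows)

vacancy : Node → ℕ → RC → Node → ℕ → ℤ
vacancy r s ν a i = + (δ a r ℕ.* (i ⊓ s)) - Σnode (λ b → cartan a b * + Qmin i (ν b))

AllRows : (Row → Set) → RiggedPartition → Set
AllRows P [] = ⊤
AllRows P (r ∷ rs) = P r × AllRows P rs

IsRC : Node → ℕ → RC → Set
IsRC r s ν = ∀ a → Sorted (ν a) × AllRows (λ row → (1 ℕ.≤ proj₁ row) × (proj₂ row ≤ vacancy r s ν a (proj₁ row))) (ν a)

IsHighestWeightRC : Node → ℕ → RC → Set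
IsHighestWeightRC r s ν = IsRC r s ν × (∀ a → AllRows (λ row → + 0 ≤ proj₂ row) (ν a))

-- Weights are written in the basis of fundamental weights: w b = coefficient of Λ_b.
Weight : Set
Weight = Node → ℤ

-- wt(ν,J) = sΛ_r − Σ_a |ν^{(a)}| α_a, using α_a = Σ_b A_{ab} Λ_b
weight : Node → ℕ → RC → Weight
weight r s ν b = + (s ℕ.* δ b r) - Σnode (λ a → + size (ν a) * cartan a b)

quadTerm : RC → ℤ
quadTerm ν = Σnode (λ a → Σnode (λ b →
  cartan a b * + sum (map (λ r → sum (map (λ r' → proj₁ r ⊓ proj₁ r') (ν b))) (ν a))))

rigSum : RC → ℤ
rigSum ν = Σnode (λ a → sumℤ (map proj₂ (ν a)))

cocharge : RC → ℤ
cocharge ν = (quadTerm ν /ℕ 2) ℤ.+ rigSum ν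

αcoeff : Node → ℕ
αcoeff zero = 0
αcoeff (suc zero) = 1
αcoeff (suc (suc zero)) = 1
αcoeff (suc (suc (suc zero))) = 2
αcoeff (suc (suc (suc (suc zero)))) = 2
αcoeff (suc (suc (suc (suc (suc zero))))) = 1

-- ν(k∗[α]) with all riggings 0: ν^{(a)} has k columns of height c_a,
-- i.e. c_a rows of length k (no rows if k = 0).
target : ℕ → RC
target zero a = []
target (suc k) a = replicate (αcoeff a) (suc k , + 0)

hwWeight : ℕ → ℕ → Weight
hwWeight s k b = + ((s ℕ.∸ k) ℕ.* δ b n5 ℕ.+ k ℕ.* δ b n1)

αWeight : Weight
αWeight b = Σnode (λ a → + αcoeff a * cartan a b)

Λ5-Λ1 : Weight
Λ5-Λ1 b = + δ b n5 - + δ b n1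

module Submission where

-- All vacancy numbers of a highest weight rigged configuration are nonnegative: on every
-- interval without row lengths i ↦ p_i^{(a)} is concave, it vanishes at i = 0, is
-- eventually constant, and at a row length it dominates a nonnegative rigging.
-- If x^{(j)}_b counts the rows of ν^{(b)} longer than j, then
-- p_{j+1}^{(a)} − p_j^{(a)} = δ_{a5}[j < s] − (A x^{(j)})_a, so Λ₅ − Σ_b x^{(0)}_b α_b is
-- dominant. As A⁻¹ ≥ 0 this bounds x^{(0)}, and a finite check leaves x^{(0)} ∈ {0, α}.
-- When x^{(j)} = α the vacancy numbers p_{j+1}^{(a)}, a ≠ 1, vanish and p_{j+1}^{(5)} ≥ 0
-- forces j < s; hence Λ₅ − Σ_b x^{(j+1)}_b α_b is dominant again and x^{(j+1)} ∈ {0, α}.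
-- So all rows of ν^{(a)} have one common length k ≤ s, there are α_a of them, and the
-- vanishing vacancy numbers squeeze every rigging to 0.

open import Defs
import Algebra.Properties.Semiring.Sum
open import Data.Empty using (⊥-elim)
open import Data.Fin as Fin using (Fin; zero; suc; toℕ; fromℕ<)
import Data.Fin.Properties as FinP
open import Data.Integer as ℤ using (ℤ; +_; _+_; _-_; _*_; -_; +≤+)
open import Data.Integer.DivMod using (_/ℕ_)
import Data.Integer.Properties as ℤP
open import Data.Integer.Tactic.RingSolver using (solve-∀)
open import Data.List using ([]; _∷_; map; replicate; length)
open import Data.Nat as ℕ using (ℕ; zero; suc; _≤_; _<_; _⊓_; z≤n; s≤s)
open import Data.Nat.DivMod using (_/_; m*n/n≡m; /-monoˡ-≤)
open import Data.Nat.ListAction using (sum)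
import Data.Nat.Properties as ℕP
open import Data.Product using (_×_; _,_; proj₁; proj₂; ∃; ∃-syntax)
open import Data.Sum using (_⊎_; inj₁; inj₂; [_,_]′)
import Data.Sum as Sum
open import Data.Unit using (tt)
open import Data.Vec using (Vec; lookup) renaming ([] to []ᵥ; _∷_ to _∷ᵥ_)
open import Function using (_∘_)
open import Function.Bundles using (_⇔_; mk⇔)
open import Relation.Binary.PropositionalEquality
  using (_≡_; _≢_; refl; sym; trans; cong; cong₂; subst; subst₂; module ≡-Reasoning)
open import Relation.Nullary using (¬_; Dec; yes; no)
open import Relation.Nullary.Decidable using (toWitness; _→-dec_; _⊎-dec_)

open import Algebra.Properties.CommutativeSemigroup ℕP.+-commutativeSemigroup
  using () renaming (interchange to +-interchange)

open import Algebra.Properties.CommutativeSemigroup ℤP.*-commutativeSemigroup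
  using () renaming (xy∙z≈xz∙y to *-rightComm)

module ℤSum = Algebra.Properties.Semiring.Sum ℤP.+-*-semiring
module ℕSum = Algebra.Properties.Semiring.Sum ℕP.+-*-semiring

sum-mono-≤ : ∀ {n} {f g : Fin n → ℤ} → (∀ i → f i ℤ.≤ g i) → ℤSum.sum f ℤ.≤ ℤSum.sum g
sum-mono-≤ {zero}  _   = ℤP.≤-refl
sum-mono-≤ {suc n} f≤g = ℤP.+-mono-≤ (f≤g zero) (sum-mono-≤ (f≤g ∘ suc))

≤-sum : ∀ {n} (f : Fin n → ℕ) i → f i ≤ ℕSum.sum f
≤-sum f zero    = ℕP.m≤m+n _ _
≤-sum f (suc i) = ℕP.≤-trans (≤-sum (f ∘ suc) i) (ℕP.m≤n+m _ _)

δ-≢ : ∀ {n} {a b : Fin n} → a ≢ b → δ a b ≡ 0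
δ-≢ {a = zero}  {zero}  a≢b = ⊥-elim (a≢b refl)
δ-≢ {a = zero}  {suc b} _   = refl
δ-≢ {a = suc a} {zero}  _   = refl
δ-≢ {a = suc a} {suc b} a≢b = δ-≢ (a≢b ∘ cong suc)

sum-δ : ∀ {n} (b : Fin n) (f : Fin n → ℤ) → ℤSum.sum (λ c → + δ b c * f c) ≡ f b
sum-δ {suc n} zero f = begin
  + 1 * f zero + ℤSum.sum {n} (λ _ → + 0) ≡⟨ cong (λ t → + 1 * f zero + t) (ℤSum.sum-replicate-zero n) ⟩
  + 1 * f zero + + 0                      ≡⟨ ℤP.+-identityʳ _ ⟩
  + 1 * f zero                            ≡⟨ ℤP.*-identityˡ _ ⟩
  f zero                                  ∎
  where open ≡-Reasoning
sum-δ {suc n} (suc b) f = trans (ℤP.+-identityˡ _) (sum-δ b (f ∘ suc))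

sum-map-replicate : ∀ {A : Set} (f : A → ℕ) m x → sum (map f (replicate m x)) ≡ m ℕ.* f x
sum-map-replicate f zero    x = refl
sum-map-replicate f (suc m) x = cong (f x ℕ.+_) (sum-map-replicate f m x)

-- Rigged partitions

AllRows-map : ∀ {P Q : Row → Set} → (∀ r → P r → Q r) → ∀ rows → AllRows P rows → AllRows Q rows
AllRows-map f []       _        = tt
AllRows-map f (r ∷ rs) (p , ps) = f r p , AllRows-map f rs ps

AllRows-zip : ∀ {P Q : Row → Set} rows → AllRows P rows → AllRows Q rows → AllRows (λ r → P r × Q r) rows
AllRows-zip []       _        _        = tt
AllRows-zip (r ∷ rs) (p , ps) (q , qs) = (p , q) , AllRows-zip rs ps qs

AllRows-replicate : ∀ {P : Row → Set} m r → P r → AllRows P (replicate m r)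
AllRows-replicate zero    r p = tt
AllRows-replicate (suc m) r p = p , AllRows-replicate m r p

AllRows-≡⇒replicate : ∀ (r₀ : Row) rows → AllRows (_≡ r₀) rows → rows ≡ replicate (length rows) r₀
AllRows-≡⇒replicate r₀ []       _        = refl
AllRows-≡⇒replicate r₀ (r ∷ rs) (p , ps) = cong₂ _∷_ p (AllRows-≡⇒replicate r₀ rs ps)

sorted-replicate : ∀ m (r : Row) → Sorted (replicate m r)
sorted-replicate zero          r = []
sorted-replicate (suc zero)    r = [ r ]
sorted-replicate (suc (suc m)) r = inj₂ (refl , ℤP.≤-refl) ∷ sorted-replicate (suc m) r

length≡0⇒[] : ∀ (rows : RiggedPartition) → length rows ≡ 0 → rows ≡ []
length≡0⇒[] [] _ = refl

row≤size : ∀ rows → AllRows (λ r → proj₁ r ≤ size rows) rows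
row≤size []       = tt
row≤size (r ∷ rs) =
  ℕP.m≤m+n (proj₁ r) (size rs) ,
  AllRows-map (λ _ p → ℕP.≤-trans p (ℕP.m≤n+m (size rs) (proj₁ r))) rs (row≤size rs)

χ< : ℕ → ℕ → ℕ
χ< i       zero    = 0
χ< zero    (suc l) = 1
χ< (suc i) (suc l) = χ< i l

χ≡ : ℕ → ℕ → ℕ
χ≡ zero    zero    = 1
χ≡ zero    (suc l) = 0
χ≡ (suc i) zero    = 0
χ≡ (suc i) (suc l) = χ≡ i l

χ<≤1 : ∀ i l → χ< i l ≤ 1
χ<≤1 i       zero    = z≤n
χ<≤1 zero    (suc l) = s≤s z≤n
χ<≤1 (suc i) (suc l) = χ<≤1 i l

χ<-≥ : ∀ {i l} → l ≤ i → χ< i l ≡ 0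
χ<-≥ {l = zero}  _         = refl
χ<-≥ {suc i} {suc l} (s≤s l≤i) = χ<-≥ l≤i

χ<-< : ∀ {i l} → i < l → χ< i l ≡ 1
χ<-< {zero}  {suc l} _         = refl
χ<-< {suc i} {suc l} (s≤s i<l) = χ<-< i<l

χ<≡1⇒< : ∀ i l → χ< i l ≡ 1 → i < l
χ<≡1⇒< zero    (suc l) _ = s≤s z≤n
χ<≡1⇒< (suc i) (suc l) p = s≤s (χ<≡1⇒< i l p)

χ<≡0⇒≥ : ∀ i l → χ< i l ≡ 0 → l ≤ i
χ<≡0⇒≥ i       zero    _ = z≤n
χ<≡0⇒≥ (suc i) (suc l) p = s≤s (χ<≡0⇒≥ i l p)

χ≡-pos⇒≡ : ∀ i l → 0 < χ≡ i l → l ≡ i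
χ≡-pos⇒≡ zero    zero    _ = refl
χ≡-pos⇒≡ (suc i) (suc l) p = cong suc (χ≡-pos⇒≡ i l p)

⊓-suc : ∀ i l → suc i ⊓ l ≡ i ⊓ l ℕ.+ χ< i l
⊓-suc zero    zero    = refl
⊓-suc (suc i) zero    = refl
⊓-suc zero    (suc l) = refl
⊓-suc (suc i) (suc l) = cong suc (⊓-suc i l)

χ<-suc : ∀ i l → χ< i l ≡ χ< (suc i) l ℕ.+ χ≡ (suc i) l
χ<-suc i       zero          = refl
χ<-suc zero    (suc zero)    = refl
χ<-suc zero    (suc (suc l)) = refl
χ<-suc (suc i) (suc l)       = χ<-suc i l

-- mult i ρ is the multiplicity m_i of the paper, and longer i ρ = Σ_{j>i} m_j.
longer mult : ℕ → RiggedPartition → ℕ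
longer i rows = sum (map (λ r → χ< i (proj₁ r)) rows)
mult   i rows = sum (map (λ r → χ≡ i (proj₁ r)) rows)

Qmin-zero : ∀ rows → Qmin 0 rows ≡ 0
Qmin-zero []       = refl
Qmin-zero (r ∷ rs) = Qmin-zero rs

Qmin-suc : ∀ i rows → Qmin (suc i) rows ≡ Qmin i rows ℕ.+ longer i rows
Qmin-suc i []       = refl
Qmin-suc i (r ∷ rs) rewrite ⊓-suc i (proj₁ r) | Qmin-suc i rs =
  +-interchange (i ⊓ proj₁ r) (χ< i (proj₁ r)) (Qmin i rs) (longer i rs)

longer-suc : ∀ i rows → longer i rows ≡ longer (suc i) rows ℕ.+ mult (suc i) rows
longer-suc i []       = refl
longer-suc i (r ∷ rs) rewrite χ<-suc i (proj₁ r) | longer-suc i rs =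
  +-interchange (χ< (suc i) (proj₁ r)) (χ≡ (suc i) (proj₁ r)) (longer (suc i) rs) (mult (suc i) rs)

longer-zero : ∀ rows → AllRows (λ r → 1 ≤ proj₁ r) rows → longer 0 rows ≡ length rows
longer-zero []       _        = refl
longer-zero (r ∷ rs) (p , ps) rewrite χ<-< p = cong suc (longer-zero rs ps)

longer≤length : ∀ i rows → longer i rows ≤ length rows
longer≤length i []       = z≤n
longer≤length i (r ∷ rs) = ℕP.+-mono-≤ (χ<≤1 i (proj₁ r)) (longer≤length i rs)

longer≡length⇒> : ∀ i rows → longer i rows ≡ length rows → AllRows (λ r → i < proj₁ r) rows
longer≡length⇒> i []       _  = tt
longer≡length⇒> i (r ∷ rs) eq = χ<≡1⇒< i (proj₁ r) head≡1 , longer≡length⇒> i rs tail≡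
  where
  head≤1 = χ<≤1 i (proj₁ r)
  tail≤  = longer≤length i rs
  head≡1 : χ< i (proj₁ r) ≡ 1
  head≡1 = ℕP.≤-antisym head≤1
    (ℕP.+-cancelʳ-≤ (longer i rs) 1 _ (ℕP.≤-trans (s≤s tail≤) (ℕP.≤-reflexive (sym eq))))
  tail≡ : longer i rs ≡ length rs
  tail≡ = ℕP.≤-antisym tail≤
    (ℕP.+-cancelˡ-≤ 1 _ _ (ℕP.≤-trans (ℕP.≤-reflexive (sym eq)) (ℕP.+-monoˡ-≤ (longer i rs) head≤1)))

longer≡0⇒≤ : ∀ i rows → longer i rows ≡ 0 → AllRows (λ r → proj₁ r ≤ i) rows
longer≡0⇒≤ i []       _  = tt
longer≡0⇒≤ i (r ∷ rs) eq =
  χ<≡0⇒≥ i (proj₁ r) (ℕP.m+n≡0⇒m≡0 _ eq) , longer≡0⇒≤ i rs (ℕP.m+n≡0⇒n≡0 (χ< i (proj₁ r)) eq)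

≤⇒longer≡0 : ∀ i rows → AllRows (λ r → proj₁ r ≤ i) rows → longer i rows ≡ 0
≤⇒longer≡0 i []       _        = refl
≤⇒longer≡0 i (r ∷ rs) (p , ps) rewrite χ<-≥ p = ≤⇒longer≡0 i rs ps

Qmin-≥ : ∀ i rows → AllRows (λ r → i ≤ proj₁ r) rows → Qmin i rows ≡ length rows ℕ.* i
Qmin-≥ i []       _        = refl
Qmin-≥ i (r ∷ rs) (p , ps) rewrite ℕP.m≤n⇒m⊓n≡m p = cong (i ℕ.+_) (Qmin-≥ i rs ps)

mult-pos⇒row : ∀ {P : Row → Set} i rows → AllRows P rows → 0 < mult i rows → ∃[ r ] (P r × proj₁ r ≡ i)
mult-pos⇒row i (r ∷ rs) (p , ps) pos with χ≡ i (proj₁ r) ℕP.≟ 0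
... | no  χ≢0 = r , p , χ≡-pos⇒≡ i (proj₁ r) (ℕP.n≢0⇒n>0 χ≢0)
... | yes χ≡0 = mult-pos⇒row i rs ps (subst (λ m → 0 < m ℕ.+ mult i rs) χ≡0 pos)

-- The Cartan matrix and dominance

cartanOn : (Node → ℕ) → Node → ℤ
cartanOn x a = Σnode (λ b → cartan a b * + x b)

cartanOn-cong : ∀ {x y} → (∀ b → x b ≡ y b) → ∀ a → cartanOn x a ≡ cartanOn y a
cartanOn-cong x≗y a = ℤSum.sum-cong-≗ (λ b → cong (λ n → cartan a b * + n) (x≗y b))

cartanOn-+ : ∀ x y a → cartanOn (λ b → x b ℕ.+ y b) a ≡ cartanOn x a + cartanOn y a
cartanOn-+ x y a = trans
  (ℤSum.sum-cong-≗ (λ b → trans (cong (cartan a b *_) (ℤP.pos-+ (x b) (y b))) (ℤP.*-distribˡ-+ (cartan a b) (+ x b) (+ y b))))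
  (ℤSum.∑-distrib-+ (λ b → cartan a b * + x b) (λ b → cartan a b * + y b))

cartanOn-*ʳ : ∀ x k a → cartanOn (λ c → x c ℕ.* k) a ≡ cartanOn x a * + k
cartanOn-*ʳ x k a = trans
  (ℤSum.sum-cong-≗ (λ c → trans (cong (cartan a c *_) (ℤP.pos-* (x c) k)) (sym (ℤP.*-assoc (cartan a c) (+ x c) (+ k)))))
  (sym (ℤSum.*-distribʳ-sum (+ k) (λ c → cartan a c * + x c)))

cartanOn-zero : ∀ a → cartanOn (λ _ → 0) a ≡ + 0
cartanOn-zero a = ℤSum.sum-cong-≗ (λ b → ℤP.*-zeroʳ (cartan a b))

cartan-offDiagonal-nonpos : ∀ {a b} → a ≢ b → cartan a b ℤ.≤ + 0
cartan-offDiagonal-nonpos {a} {b} a≢b rewrite δ-≢ a≢b =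
  subst (ℤ._≤ + 0) (sym (ℤP.+-identityˡ (- + adj a b))) (ℤP.neg-mono-≤ (+≤+ z≤n))

cartanOn-nonpos : ∀ x a → x a ≡ 0 → cartanOn x a ℤ.≤ + 0
cartanOn-nonpos x a xa≡0 = sum-mono-≤ term-nonpos
  where
  term-nonpos : ∀ b → cartan a b * + x b ℤ.≤ + 0
  term-nonpos b with a Fin.≟ b
  ... | yes refl = ℤP.≤-reflexive (trans (cong (λ n → cartan a a * + n) xa≡0) (ℤP.*-zeroʳ (cartan a a)))
  ... | no  a≢b  = ℤP.*-monoʳ-≤-nonNeg (+ x b) (cartan-offDiagonal-nonpos a≢b)

cartanOn-α : ∀ a → cartanOn αcoeff a ≡ + δ a n5 - + δ a n1
cartanOn-α = toWitness {a? = FinP.all? (λ a → cartanOn αcoeff a ℤ.≟ + δ a n5 - + δ a n1)} tt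

αWeight≡Λ5-Λ1 : ∀ b → αWeight b ≡ Λ5-Λ1 b
αWeight≡Λ5-Λ1 = toWitness {a? = FinP.all? (λ b → αWeight b ℤ.≟ Λ5-Λ1 b)} tt

-- Dominance of Λ₅ − Σ_b x_b α_b, whose Λ_a-coordinate is δ_{a5} − (A x)_a.
Dominant : (Node → ℕ) → Set
Dominant x = ∀ a → cartanOn x a ℤ.≤ + δ a n5

Dominant-resp : ∀ {x y} → (∀ b → x b ≡ y b) → Dominant x → Dominant y
Dominant-resp x≗y dom a = subst (ℤ._≤ _) (cartanOn-cong x≗y a) (dom a)

-- 3A⁻¹; the inverse Cartan matrix of E₆ has nonnegative entries in ⅓ℤ.
threeCartanInverse : Node → Node → ℕ
threeCartanInverse b a = lookup (lookup table b) a
  where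
  table : Vec (Vec ℕ 6) 6
  table = (4 ∷ᵥ 3 ∷ᵥ 5 ∷ᵥ  6 ∷ᵥ  4 ∷ᵥ 2 ∷ᵥ []ᵥ)
       ∷ᵥ (3 ∷ᵥ 6 ∷ᵥ 6 ∷ᵥ  9 ∷ᵥ  6 ∷ᵥ 3 ∷ᵥ []ᵥ)
       ∷ᵥ (5 ∷ᵥ 6 ∷ᵥ 10 ∷ᵥ 12 ∷ᵥ 8 ∷ᵥ 4 ∷ᵥ []ᵥ)
       ∷ᵥ (6 ∷ᵥ 9 ∷ᵥ 12 ∷ᵥ 18 ∷ᵥ 12 ∷ᵥ 6 ∷ᵥ []ᵥ)
       ∷ᵥ (4 ∷ᵥ 6 ∷ᵥ 8 ∷ᵥ 12 ∷ᵥ 10 ∷ᵥ 5 ∷ᵥ []ᵥ)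
       ∷ᵥ (2 ∷ᵥ 3 ∷ᵥ 4 ∷ᵥ  6 ∷ᵥ  5 ∷ᵥ 4 ∷ᵥ []ᵥ)
       ∷ᵥ []ᵥ

threeCartanInverse-cartan : ∀ b c → Σnode (λ a → + threeCartanInverse b a * cartan a c) ≡ + δ b c * + 3
threeCartanInverse-cartan = toWitness {a? = FinP.all? λ b → FinP.all? λ c →
  Σnode (λ a → + threeCartanInverse b a * cartan a c) ℤ.≟ + δ b c * + 3} tt

threeCartanInverse-column5 : ∀ b → Σnode (λ a → + threeCartanInverse b a * + δ a n5) ≡ + threeCartanInverse b n5
threeCartanInverse-column5 = toWitness {a? = FinP.all? λ b →
  Σnode (λ a → + threeCartanInverse b a * + δ a n5) ℤ.≟ + threeCartanInverse b n5} tt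

threeCartanInverse-cartanOn : ∀ x b → Σnode (λ a → + threeCartanInverse b a * cartanOn x a) ≡ + 3 * + x b
threeCartanInverse-cartanOn x b = begin
  Σnode (λ a → M b a * Σnode (λ c → cartan a c * X c))
    ≡⟨ ℤSum.sum-cong-≗ (λ a → ℤSum.*-distribˡ-sum (M b a) (λ c → cartan a c * X c)) ⟩
  Σnode (λ a → Σnode (λ c → M b a * (cartan a c * X c)))
    ≡⟨ ℤSum.∑-comm (λ a c → M b a * (cartan a c * X c)) ⟩
  Σnode (λ c → Σnode (λ a → M b a * (cartan a c * X c)))
    ≡⟨ ℤSum.sum-cong-≗ (λ c → trans (ℤSum.sum-cong-≗ (λ a → sym (ℤP.*-assoc (M b a) (cartan a c) (X c))))
                                     (sym (ℤSum.*-distribʳ-sum (X c) (λ a → M b a * cartan a c)))) ⟩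
  Σnode (λ c → Σnode (λ a → M b a * cartan a c) * X c)
    ≡⟨ ℤSum.sum-cong-≗ (λ c → trans (cong (_* X c) (threeCartanInverse-cartan b c)) (ℤP.*-assoc (+ δ b c) (+ 3) (X c))) ⟩
  Σnode (λ c → + δ b c * (+ 3 * X c))
    ≡⟨ sum-δ b (λ c → + 3 * X c) ⟩
  + 3 * X b ∎
  where
  open ≡-Reasoning
  M : Node → Node → ℤ
  M b a = + threeCartanInverse b a
  X : Node → ℤ
  X c = + x c

dominantBound : Node → ℕ
dominantBound b = threeCartanInverse b n5 / 3

dominant⇒3x≤3A⁻¹ : ∀ x → Dominant x → ∀ b → 3 ℕ.* x b ≤ threeCartanInverse b n5
dominant⇒3x≤3A⁻¹ x dom b = ℤ.drop‿+≤+ (begin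
  + (3 ℕ.* x b)                                          ≡⟨ ℤP.pos-* 3 (x b) ⟩
  + 3 * + x b                                            ≡⟨ threeCartanInverse-cartanOn x b ⟨
  Σnode (λ a → + threeCartanInverse b a * cartanOn x a)  ≤⟨ sum-mono-≤ (λ a → ℤP.*-monoˡ-≤-nonNeg (+ threeCartanInverse b a) (dom a)) ⟩
  Σnode (λ a → + threeCartanInverse b a * + δ a n5)      ≡⟨ threeCartanInverse-column5 b ⟩
  + threeCartanInverse b n5                              ∎)
  where open ℤP.≤-Reasoning

dominant-bounded : ∀ x → Dominant x → ∀ b → x b ≤ dominantBound b
dominant-bounded x dom b = begin
  x b             ≡⟨ m*n/n≡m (x b) 3 ⟨
  x b ℕ.* 3 / 3   ≡⟨ cong (_/ 3) (ℕP.*-comm (x b) 3) ⟩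
  3 ℕ.* x b / 3   ≤⟨ /-monoˡ-≤ 3 (dominant⇒3x≤3A⁻¹ x dom b) ⟩
  dominantBound b ∎
  where open ℕP.≤-Reasoning

IsZeroOrα : (Node → ℕ) → Set
IsZeroOrα x = (∀ b → x b ≡ 0) ⊎ (∀ b → x b ≡ αcoeff b)

IsZeroOrα-resp : ∀ {x y} → (∀ b → x b ≡ y b) → IsZeroOrα x → IsZeroOrα y
IsZeroOrα-resp x≗y = Sum.map (λ x≡0 b → trans (sym (x≗y b)) (x≡0 b)) (λ x≡α b → trans (sym (x≗y b)) (x≡α b))

-- Fin 2, Fin 3, … are Fin (suc (dominantBound b)) for b = 1, …, 6.
boxPoint : Fin 2 → Fin 3 → Fin 3 → Fin 5 → Fin 4 → Fin 2 → Node → ℕ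
boxPoint i₁ i₂ i₃ i₄ i₅ i₆ zero                                   = toℕ i₁
boxPoint i₁ i₂ i₃ i₄ i₅ i₆ (suc zero)                             = toℕ i₂
boxPoint i₁ i₂ i₃ i₄ i₅ i₆ (suc (suc zero))                       = toℕ i₃
boxPoint i₁ i₂ i₃ i₄ i₅ i₆ (suc (suc (suc zero)))                 = toℕ i₄
boxPoint i₁ i₂ i₃ i₄ i₅ i₆ (suc (suc (suc (suc zero))))           = toℕ i₅
boxPoint i₁ i₂ i₃ i₄ i₅ i₆ (suc (suc (suc (suc (suc zero)))))     = toℕ i₆

boxPoint-classification : ∀ i₁ i₂ i₃ i₄ i₅ i₆ → let x = boxPoint i₁ i₂ i₃ i₄ i₅ i₆ in Dominant x → IsZeroOrα x
boxPoint-classification = toWitness {a? =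
  FinP.all? λ i₁ → FinP.all? λ i₂ → FinP.all? λ i₃ → FinP.all? λ i₄ → FinP.all? λ i₅ → FinP.all? λ i₆ →
  let x = boxPoint i₁ i₂ i₃ i₄ i₅ i₆ in
  FinP.all? (λ a → cartanOn x a ℤP.≤? + δ a n5)
    →-dec (FinP.all? (λ b → x b ℕP.≟ 0) ⊎-dec FinP.all? (λ b → x b ℕP.≟ αcoeff b))} tt

dominant-classification : ∀ x → Dominant x → IsZeroOrα x
dominant-classification x dom =
  IsZeroOrα-resp point≗x (boxPoint-classification _ _ _ _ _ _ (Dominant-resp (sym ∘ point≗x) dom))
  where
  coord : ∀ b → Fin (suc (dominantBound b))
  coord b = fromℕ< (s≤s (dominant-bounded x dom b))
  point≗x : ∀ b → boxPoint (coord n1) (coord n2) (coord n3) (coord n4) (coord n5) (coord n6) b ≡ x b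
  point≗x zero                               = FinP.toℕ-fromℕ< _
  point≗x (suc zero)                         = FinP.toℕ-fromℕ< _
  point≗x (suc (suc zero))                   = FinP.toℕ-fromℕ< _
  point≗x (suc (suc (suc zero)))             = FinP.toℕ-fromℕ< _
  point≗x (suc (suc (suc (suc zero))))       = FinP.toℕ-fromℕ< _
  point≗x (suc (suc (suc (suc (suc zero))))) = FinP.toℕ-fromℕ< _

-- Concavity

module _ (p g : ℕ → ℤ) (HasRow : ℕ → Set) (hasRow? : ∀ i → Dec (HasRow i)) (N : ℕ)
         (p-zero : p 0 ≡ + 0)
         (p-suc : ∀ i → p (suc i) ≡ p i + g i)
         (g-antitone : ∀ i → ¬ HasRow (suc i) → g (suc i) ℤ.≤ g i)
         (g-vanishes : ∀ i → N ≤ i → g i ≡ + 0)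
         (p-nonneg-at-rows : ∀ i → HasRow i → + 0 ℤ.≤ p i)
  where

  private
    nonneg-before-ascent : ∀ i → + 0 ℤ.≤ g i → + 0 ℤ.≤ p i
    nonneg-before-ascent zero    _   = ℤP.≤-reflexive (sym p-zero)
    nonneg-before-ascent (suc i) 0≤g with hasRow? (suc i)
    ... | yes row = p-nonneg-at-rows (suc i) row
    ... | no  ¬row = subst (+ 0 ℤ.≤_) (sym (p-suc i)) (ℤP.+-mono-≤ (nonneg-before-ascent i 0≤gᵢ) 0≤gᵢ)
      where 0≤gᵢ = ℤP.≤-trans 0≤g (g-antitone i ¬row)

    nonneg-before-descent : ∀ d i → N ≤ d ℕ.+ i → g i ℤ.< + 0 → + 0 ℤ.≤ p i
    nonneg-before-descent zero    i N≤i g<0 = ⊥-elim (ℤP.<-irrefl (g-vanishes i N≤i) g<0)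
    nonneg-before-descent (suc d) i N≤  g<0 =
      ℤP.≤-trans 0≤pᵢ₊₁ (ℤP.≤-trans (ℤP.≤-reflexive (p-suc i))
        (subst (p i + g i ℤ.≤_) (ℤP.+-identityʳ (p i)) (ℤP.+-monoʳ-≤ (p i) (ℤP.<⇒≤ g<0))))
      where
      0≤pᵢ₊₁ : + 0 ℤ.≤ p (suc i)
      0≤pᵢ₊₁ with hasRow? (suc i)
      ... | yes row  = p-nonneg-at-rows (suc i) row
      ... | no  ¬row = nonneg-before-descent d (suc i) (subst (N ≤_) (sym (ℕP.+-suc d i)) N≤)
                                                        (ℤP.≤-<-trans (g-antitone i ¬row) g<0)

  -- Where g i ≥ 0, walk left to a row or to 0; where g i < 0, walk right to a row,
  -- which must come before g vanishes.
  concave-nonneg : ∀ i → + 0 ℤ.≤ p i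
  concave-nonneg i with + 0 ℤP.≤? g i
  ... | yes 0≤g = nonneg-before-ascent i 0≤g
  ... | no  0≰g = nonneg-before-descent N i (ℕP.m≤m+n N i) (ℤP.≰⇒> 0≰g)

invariant-escapes : ∀ {P Q : ℕ → Set} N → (∀ i → N ≤ i → ¬ P i) → (∀ j → P j → P (suc j) ⊎ Q j) → P 0 → ∃ Q
invariant-escapes {P} {Q} N eventually-¬P step = go N 0 (ℕP.m≤m+n N 0)
  where
  go : ∀ d j → N ≤ d ℕ.+ j → P j → ∃ Q
  go zero    j N≤j  pⱼ = ⊥-elim (eventually-¬P j N≤j pⱼ)
  go (suc d) j N≤   pⱼ with step j pⱼ
  ... | inj₁ pⱼ₊₁ = go d (suc j) (subst (N ≤_) (sym (ℕP.+-suc d j)) N≤) pⱼ₊₁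
  ... | inj₂ qⱼ   = j , qⱼ

-- Vacancy numbers

totalSize : RC → ℕ
totalSize ν = ℕSum.sum (λ b → size (ν b))

longer-beyond-totalSize : ∀ ν {i} → totalSize ν ≤ i → ∀ b → longer i (ν b) ≡ 0
longer-beyond-totalSize ν total≤i b =
  ≤⇒longer≡0 _ (ν b) (AllRows-map (λ _ l≤ → ℕP.≤-trans l≤ size≤i) (ν b) (row≤size (ν b)))
  where size≤i = ℕP.≤-trans (≤-sum (λ c → size (ν c)) b) total≤i

vacancyStep : Node → ℕ → RC → Node → ℕ → ℤ
vacancyStep r s ν a i = + (δ a r ℕ.* χ< i s) - cartanOn (λ b → longer i (ν b)) a

+-−-interchange : ∀ (m n k l : ℤ) → (m + n) - (k + l) ≡ (m - k) + (n - l)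
+-−-interchange = solve-∀

module _ (r : Node) (s : ℕ) (ν : RC) (a : Node) where

  vacancy-zero : vacancy r s ν a 0 ≡ + 0
  vacancy-zero = cong₂ (λ m n → + m - n) (ℕP.*-zeroʳ (δ a r))
    (trans (cartanOn-cong (Qmin-zero ∘ ν) a) (cartanOn-zero a))

  vacancy-suc : ∀ i → vacancy r s ν a (suc i) ≡ vacancy r s ν a i + vacancyStep r s ν a i
  vacancy-suc i = begin
    + (δ a r ℕ.* (suc i ⊓ s)) - cartanOn (λ b → Qmin (suc i) (ν b)) a
      ≡⟨ cong₂ _-_ (cong +_ (trans (cong (δ a r ℕ.*_) (⊓-suc i s)) (ℕP.*-distribˡ-+ (δ a r) (i ⊓ s) (χ< i s))))
                   (cartanOn-cong (λ b → Qmin-suc i (ν b)) a) ⟩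
    + (δ a r ℕ.* (i ⊓ s) ℕ.+ δ a r ℕ.* χ< i s) - cartanOn (λ b → Qmin i (ν b) ℕ.+ longer i (ν b)) a
      ≡⟨ cong (_-_ (+ (δ a r ℕ.* (i ⊓ s) ℕ.+ δ a r ℕ.* χ< i s))) (cartanOn-+ (λ b → Qmin i (ν b)) (λ b → longer i (ν b)) a) ⟩
    (+ (δ a r ℕ.* (i ⊓ s)) + + (δ a r ℕ.* χ< i s)) - (cartanOn (λ b → Qmin i (ν b)) a + cartanOn (λ b → longer i (ν b)) a)
      ≡⟨ +-−-interchange (+ (δ a r ℕ.* (i ⊓ s))) (+ (δ a r ℕ.* χ< i s))
                         (cartanOn (λ b → Qmin i (ν b)) a) (cartanOn (λ b → longer i (ν b)) a) ⟩
    vacancy r s ν a i + vacancyStep r s ν a i ∎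
    where open ≡-Reasoning

  vacancyStep-suc : ∀ i → vacancyStep r s ν a i ≡
    vacancyStep r s ν a (suc i) + (+ (δ a r ℕ.* χ≡ (suc i) s) - cartanOn (λ b → mult (suc i) (ν b)) a)
  vacancyStep-suc i = begin
    + (δ a r ℕ.* χ< i s) - cartanOn (λ b → longer i (ν b)) a
      ≡⟨ cong₂ _-_ (cong +_ (trans (cong (δ a r ℕ.*_) (χ<-suc i s)) (ℕP.*-distribˡ-+ (δ a r) _ _)))
                   (cartanOn-cong (λ b → longer-suc i (ν b)) a) ⟩
    + (δ a r ℕ.* χ< (suc i) s ℕ.+ δ a r ℕ.* χ≡ (suc i) s) - cartanOn (λ b → longer (suc i) (ν b) ℕ.+ mult (suc i) (ν b)) a
      ≡⟨ cong (_-_ (+ (δ a r ℕ.* χ< (suc i) s ℕ.+ δ a r ℕ.* χ≡ (suc i) s))) (cartanOn-+ (λ b → longer (suc i) (ν b)) (λ b → mult (suc i) (ν b)) a) ⟩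
    (+ (δ a r ℕ.* χ< (suc i) s) + + (δ a r ℕ.* χ≡ (suc i) s))
      - (cartanOn (λ b → longer (suc i) (ν b)) a + cartanOn (λ b → mult (suc i) (ν b)) a)
      ≡⟨ +-−-interchange (+ (δ a r ℕ.* χ< (suc i) s)) (+ (δ a r ℕ.* χ≡ (suc i) s))
                           (cartanOn (λ b → longer (suc i) (ν b)) a) (cartanOn (λ b → mult (suc i) (ν b)) a) ⟩
    vacancyStep r s ν a (suc i) + (+ (δ a r ℕ.* χ≡ (suc i) s) - cartanOn (λ b → mult (suc i) (ν b)) a) ∎
    where open ≡-Reasoning

  vacancyStep-antitone : ∀ i → mult (suc i) (ν a) ≡ 0 → vacancyStep r s ν a (suc i) ℤ.≤ vacancyStep r s ν a i
  vacancyStep-antitone i no-row =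
    subst₂ ℤ._≤_ (ℤP.+-identityʳ _) (sym (vacancyStep-suc i)) (ℤP.+-monoʳ-≤ (vacancyStep r s ν a (suc i)) 0≤d)
    where
    0≤d : + 0 ℤ.≤ + (δ a r ℕ.* χ≡ (suc i) s) - cartanOn (λ b → mult (suc i) (ν b)) a
    0≤d = ℤP.i≤j⇒0≤j-i (ℤP.≤-trans (cartanOn-nonpos (λ b → mult (suc i) (ν b)) a no-row) (+≤+ z≤n))

  vacancyStep-vanishes : ∀ i → s ℕ.+ totalSize ν ≤ i → vacancyStep r s ν a i ≡ + 0
  vacancyStep-vanishes i N≤i = cong₂ (λ m n → + m - n)
    (trans (cong (δ a r ℕ.*_) (χ<-≥ (ℕP.≤-trans (ℕP.m≤m+n s _) N≤i))) (ℕP.*-zeroʳ (δ a r)))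
    (trans (cartanOn-cong (longer-beyond-totalSize ν (ℕP.≤-trans (ℕP.m≤n+m _ s) N≤i)) a) (cartanOn-zero a))

  vacancyStep-nonneg⇒bounded : ∀ i → + 0 ℤ.≤ vacancyStep r s ν a i → cartanOn (λ b → longer i (ν b)) a ℤ.≤ + δ a r
  vacancyStep-nonneg⇒bounded i 0≤step = ℤP.≤-trans (ℤP.0≤i-j⇒j≤i 0≤step)
    (+≤+ (ℕP.≤-trans (ℕP.*-monoʳ-≤ (δ a r) (χ<≤1 i s)) (ℕP.≤-reflexive (ℕP.*-identityʳ (δ a r)))))

  vacancyStep-nonneg : ∀ i → vacancy r s ν a i ≡ + 0 → + 0 ℤ.≤ vacancy r s ν a (suc i) → + 0 ℤ.≤ vacancyStep r s ν a i
  vacancyStep-nonneg i pᵢ≡0 0≤pᵢ₊₁ = subst (+ 0 ℤ.≤_)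
    (trans (vacancy-suc i) (trans (cong (_+ vacancyStep r s ν a i) pᵢ≡0) (ℤP.+-identityˡ _))) 0≤pᵢ₊₁

vacancy-nonneg : ∀ {r s ν} → IsHighestWeightRC r s ν → ∀ a i → + 0 ℤ.≤ vacancy r s ν a i
vacancy-nonneg {r} {s} {ν} (isRC , riggings-nonneg) a =
  concave-nonneg (vacancy r s ν a) (vacancyStep r s ν a) (λ i → 0 < mult i (ν a)) (λ i → 0 ℕP.<? mult i (ν a))
    (s ℕ.+ totalSize ν) (vacancy-zero r s ν a) (vacancy-suc r s ν a)
    (λ i ¬row → vacancyStep-antitone r s ν a i (ℕP.n≤0⇒n≡0 (ℕP.≮⇒≥ ¬row))) (vacancyStep-vanishes r s ν a) nonneg-at-rows
  where
  nonneg-at-rows : ∀ i → 0 < mult i (ν a) → + 0 ℤ.≤ vacancy r s ν a i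
  nonneg-at-rows i row with mult-pos⇒row i (ν a) (AllRows-zip (ν a) (proj₂ (isRC a)) (riggings-nonneg a)) row
  ... | _ , ((_ , x≤p) , 0≤x) , refl = ℤP.≤-trans 0≤x x≤p

module _ (s : ℕ) (ν : RC) (K : ℕ) (Qmin≡ : ∀ c → Qmin K (ν c) ≡ αcoeff c ℕ.* K) where

  vacancy-α : ∀ a → vacancy n5 s ν a K ≡ + δ a n5 * (+ (K ⊓ s) - + K) + + δ a n1 * + K
  vacancy-α a = begin
    + (δ a n5 ℕ.* (K ⊓ s)) - cartanOn (λ c → Qmin K (ν c)) a
      ≡⟨ cong₂ _-_ (ℤP.pos-* (δ a n5) (K ⊓ s))
                   (trans (cartanOn-cong Qmin≡ a) (trans (cartanOn-*ʳ αcoeff K a) (cong (_* + K) (cartanOn-α a)))) ⟩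
    + δ a n5 * + (K ⊓ s) - (+ δ a n5 - + δ a n1) * + K
      ≡⟨ regroup (+ δ a n5) (+ δ a n1) (+ (K ⊓ s)) (+ K) ⟩
    + δ a n5 * (+ (K ⊓ s) - + K) + + δ a n1 * + K ∎
    where
    open ≡-Reasoning
    regroup : ∀ (d₅ d₁ m k : ℤ) → d₅ * m - (d₅ - d₁) * k ≡ d₅ * (m - k) + d₁ * k
    regroup = solve-∀

  vacancy-α-n5 : + 0 ℤ.≤ vacancy n5 s ν n5 K → K ≤ s
  vacancy-α-n5 0≤p = ℕP.≤-trans (ℤ.drop‿+≤+ (ℤP.0≤i-j⇒j≤i (subst (+ 0 ℤ.≤_) p≡ 0≤p))) (ℕP.m⊓n≤n K s)
    where
    p≡ : vacancy n5 s ν n5 K ≡ + (K ⊓ s) - + K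
    p≡ = trans (vacancy-α n5) (trans (ℤP.+-identityʳ _) (ℤP.*-identityˡ _))

  module _ (K≤s : K ≤ s) (a : Node) where

    vacancy-α-≤ : vacancy n5 s ν a K ≡ + δ a n1 * + K
    vacancy-α-≤ = trans (vacancy-α a) (begin
      + δ a n5 * (+ (K ⊓ s) - + K) + + δ a n1 * + K
        ≡⟨ cong (λ m → + δ a n5 * (+ m - + K) + + δ a n1 * + K) (ℕP.m≤n⇒m⊓n≡m K≤s) ⟩
      + δ a n5 * (+ K - + K) + + δ a n1 * + K
        ≡⟨ cong (λ d → + δ a n5 * d + + δ a n1 * + K) (ℤP.+-inverseʳ (+ K)) ⟩
      + δ a n5 * + 0 + + δ a n1 * + K
        ≡⟨ cong (_+ + δ a n1 * + K) (ℤP.*-zeroʳ (+ δ a n5)) ⟩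
      + 0 + + δ a n1 * + K
        ≡⟨ ℤP.+-identityˡ _ ⟩
      + δ a n1 * + K ∎)
      where open ≡-Reasoning

    vacancy-α-nonneg : + 0 ℤ.≤ vacancy n5 s ν a K
    vacancy-α-nonneg = subst (+ 0 ℤ.≤_) (trans (ℤP.pos-* (δ a n1) K) (sym vacancy-α-≤)) (+≤+ z≤n)

    vacancy-α-≢n1 : a ≢ n1 → vacancy n5 s ν a K ≡ + 0
    vacancy-α-≢n1 a≢n1 = trans vacancy-α-≤ (cong (λ d → + d * + K) (δ-≢ a≢n1))

-- Highest weight rigged configurations

module HighestWeight {s : ℕ} {ν : RC} (hw : IsHighestWeightRC n5 s ν) where

  rowsValid : ∀ a → AllRows (λ row → (1 ≤ proj₁ row × proj₂ row ℤ.≤ vacancy n5 s ν a (proj₁ row)) × + 0 ℤ.≤ proj₂ row) (ν a)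
  rowsValid a = AllRows-zip (ν a) (proj₂ (proj₁ hw a)) (proj₂ hw a)

  -- level j is the vector x^{(j)}.
  level : ℕ → Node → ℕ
  level j b = longer j (ν b)

  level-zero : ∀ b → level 0 b ≡ length (ν b)
  level-zero b = longer-zero (ν b) (AllRows-map (λ _ → proj₁ ∘ proj₁) (ν b) (rowsValid b))

  level-zero-dominant : Dominant (level 0)
  level-zero-dominant a = vacancyStep-nonneg⇒bounded n5 s ν a 0
    (vacancyStep-nonneg n5 s ν a 0 (vacancy-zero n5 s ν a) (vacancy-nonneg hw a 1))

  AtLevel : ℕ → Set
  AtLevel j = ∀ b → level j b ≡ αcoeff b

  module αCase (level-zero≡α : AtLevel 0) where

    length≡α : ∀ b → length (ν b) ≡ αcoeff b
    length≡α b = trans (sym (level-zero b)) (level-zero≡α b)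

    module _ {j : ℕ} (atJ : AtLevel j) where

      rows-longer : ∀ b → AllRows (λ row → j < proj₁ row) (ν b)
      rows-longer b = longer≡length⇒> j (ν b) (trans (atJ b) (sym (length≡α b)))

      Qmin≡ : ∀ c → Qmin (suc j) (ν c) ≡ αcoeff c ℕ.* suc j
      Qmin≡ c = trans (Qmin-≥ (suc j) (ν c) (rows-longer c)) (cong (ℕ._* suc j) (length≡α c))

      suc-j≤s : suc j ≤ s
      suc-j≤s = vacancy-α-n5 s ν (suc j) Qmin≡ (vacancy-nonneg hw n5 (suc j))

      next-dominant : Dominant (level (suc j))
      next-dominant a with a Fin.≟ n1
      ... | yes refl = ℤP.≤-trans (cartanOn-nonpos (level (suc j)) n1 no-longer-rows) (+≤+ z≤n)
        where
        no-longer-rows : level (suc j) n1 ≡ 0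
        no-longer-rows = ℕP.n≤0⇒n≡0 (ℕP.≤-trans (ℕP.m≤m+n _ _)
          (ℕP.≤-reflexive (trans (sym (longer-suc j (ν n1))) (atJ n1))))
      ... | no a≢n1 = vacancyStep-nonneg⇒bounded n5 s ν a (suc j)
        (vacancyStep-nonneg n5 s ν a (suc j) (vacancy-α-≢n1 s ν (suc j) Qmin≡ suc-j≤s a a≢n1) (vacancy-nonneg hw a (suc (suc j))))

      rows-exact : (∀ b → level (suc j) b ≡ 0) → ∀ a → ν a ≡ target (suc j) a
      rows-exact beyond a with a Fin.≟ n1
      ... | yes refl = length≡0⇒[] (ν n1) (length≡α n1)
      ... | no a≢n1 = trans (AllRows-≡⇒replicate (suc j , + 0) (ν a) rows≡)
                            (cong (λ m → replicate m (suc j , + 0)) (length≡α a))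
        where
        rows≡ : AllRows (_≡ (suc j , + 0)) (ν a)
        rows≡ = AllRows-map row≡ (ν a)
          (AllRows-zip (ν a) (AllRows-zip (ν a) (rows-longer a) (longer≡0⇒≤ (suc j) (ν a) (beyond a))) (rowsValid a))
          where
          row≡ : ∀ row → (j < proj₁ row × proj₁ row ≤ suc j)
                       × ((1 ≤ proj₁ row × proj₂ row ℤ.≤ vacancy n5 s ν a (proj₁ row)) × + 0 ℤ.≤ proj₂ row)
                       → row ≡ (suc j , + 0)
          row≡ (l , x) ((j<l , l≤) , (_ , x≤p) , 0≤x) with ℕP.≤-antisym l≤ j<l
          ... | refl = cong (suc j ,_)
            (ℤP.≤-antisym (subst (x ℤ.≤_) (vacancy-α-≢n1 s ν (suc j) Qmin≡ suc-j≤s a a≢n1) x≤p) 0≤x)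

    not-AtLevel : ∀ i → totalSize ν ≤ i → ¬ AtLevel i
    not-AtLevel i total≤i atI with trans (sym (atI n4)) (longer-beyond-totalSize ν total≤i n4)
    ... | ()

    step : ∀ j → AtLevel j → AtLevel (suc j) ⊎ (suc j ≤ s × ∀ a → ν a ≡ target (suc j) a)
    step j atJ = [ (λ level≡0 → inj₂ (suc-j≤s atJ , rows-exact atJ level≡0)) , inj₁ ]′
      (dominant-classification (level (suc j)) (next-dominant atJ))

  classification : ∃[ k ] (k ≤ s × ∀ a → ν a ≡ target k a)
  classification = [ empty , nonempty ]′ (dominant-classification (level 0) level-zero-dominant)
    where
    empty : (∀ b → level 0 b ≡ 0) → ∃[ k ] (k ≤ s × ∀ a → ν a ≡ target k a)
    empty level≡0 = 0 , z≤n , λ a → length≡0⇒[] (ν a) (trans (sym (level-zero a)) (level≡0 a))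
    nonempty : AtLevel 0 → ∃[ k ] (k ≤ s × ∀ a → ν a ≡ target k a)
    nonempty level≡α =
      let j , result = invariant-escapes (totalSize ν) (αCase.not-AtLevel level≡α) (αCase.step level≡α) level≡α
      in suc j , result

-- The configurations ν(k ∗ [α])

size-target : ∀ k a → size (target k a) ≡ αcoeff a ℕ.* k
size-target zero    a = sym (ℕP.*-zeroʳ (αcoeff a))
size-target (suc k) a = sum-map-replicate proj₁ (αcoeff a) (suc k , + 0)

Qmin-target : ∀ k c → Qmin k (target k c) ≡ αcoeff c ℕ.* k
Qmin-target zero    c = sym (ℕP.*-zeroʳ (αcoeff c))
Qmin-target (suc k) c =
  trans (sum-map-replicate (λ r → suc k ⊓ proj₁ r) (αcoeff c) (suc k , + 0)) (cong (αcoeff c ℕ.*_) (ℕP.⊓-idem (suc k)))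

isHighestWeight-target : ∀ {s k ν} → k ≤ s → (∀ a → ν a ≡ target k a) → IsHighestWeightRC n5 s ν
isHighestWeight-target {s} {zero} {ν} _ ν≡ =
  (λ a → subst Sorted (sym (ν≡ a)) [] , subst (AllRows _) (sym (ν≡ a)) tt) , λ a → subst (AllRows _) (sym (ν≡ a)) tt
isHighestWeight-target {s} {suc k} {ν} k≤s ν≡ =
  (λ a → subst Sorted (sym (ν≡ a)) (sorted-replicate (αcoeff a) row) , rows (valid a)) , λ a → rows ℤP.≤-refl
  where
  row = (suc k , + 0)
  rows : ∀ {P a} → P row → AllRows P (ν a)
  rows {P} {a} p = subst (AllRows P) (sym (ν≡ a)) (AllRows-replicate (αcoeff a) row p)
  valid : ∀ a → 1 ≤ suc k × + 0 ℤ.≤ vacancy n5 s ν a (suc k)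
  valid a = s≤s z≤n , vacancy-α-nonneg s ν (suc k) (λ c → trans (cong (Qmin (suc k)) (ν≡ c)) (Qmin-target (suc k) c)) k≤s a

weight-target : ∀ {s k} → k ≤ s → ∀ b → weight n5 s (target k) b ≡ hwWeight s k b
weight-target {s} {k} k≤s b = begin
  + (s ℕ.* δ b n5) - Σnode (λ a → + size (target k a) * cartan a b)
    ≡⟨ cong₂ _-_ (ℤP.pos-* s (δ b n5)) Σ≡ ⟩
  + s * + δ b n5 - (+ δ b n5 - + δ b n1) * + k
    ≡⟨ regroup (+ s) (+ k) (+ δ b n5) (+ δ b n1) ⟩
  (+ s - + k) * + δ b n5 + + k * + δ b n1
    ≡⟨ cong₂ _+_ (cong (_* + δ b n5) (trans (ℤP.m-n≡m⊖n s k) (ℤP.⊖-≥ k≤s))) refl ⟩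
  + (s ℕ.∸ k) * + δ b n5 + + k * + δ b n1
    ≡⟨ cong₂ _+_ (ℤP.pos-* (s ℕ.∸ k) (δ b n5)) (ℤP.pos-* k (δ b n1)) ⟨
  + ((s ℕ.∸ k) ℕ.* δ b n5 ℕ.+ k ℕ.* δ b n1) ∎
  where
  open ≡-Reasoning
  regroup : ∀ (s k d₅ d₁ : ℤ) → s * d₅ - (d₅ - d₁) * k ≡ (s - k) * d₅ + k * d₁
  regroup = solve-∀
  Σ≡ : Σnode (λ a → + size (target k a) * cartan a b) ≡ (+ δ b n5 - + δ b n1) * + k
  Σ≡ = trans (ℤSum.sum-cong-≗ (λ a → trans (cong (λ n → + n * cartan a b) (size-target k a))
                                  (trans (cong (_* cartan a b) (ℤP.pos-* (αcoeff a) k)) (*-rightComm (+ αcoeff a) (+ k) (cartan a b)))))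
        (trans (sym (ℤSum.*-distribʳ-sum (+ k) (λ a → + αcoeff a * cartan a b))) (cong (_* + k) (αWeight≡Λ5-Λ1 b)))

-- α is a real root: (α, α) = 2.
α-norm : Σnode (λ a → Σnode (λ b → cartan a b * + (αcoeff a ℕ.* αcoeff b))) ≡ + 2
α-norm = refl

quadTerm-target : ∀ k → quadTerm (target (suc k)) ≡ + 2 * + suc k
quadTerm-target k = begin
  quadTerm (target (suc k))
    ≡⟨ ℤSum.sum-cong-≗ (λ a → ℤSum.sum-cong-≗ (term a)) ⟩
  Σnode (λ a → Σnode (λ b → cartan a b * αα a b * + suc k))
    ≡⟨ ℤSum.sum-cong-≗ (λ a → ℤSum.*-distribʳ-sum (+ suc k) (λ b → cartan a b * αα a b)) ⟨
  Σnode (λ a → Σnode (λ b → cartan a b * αα a b) * + suc k)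
    ≡⟨ ℤSum.*-distribʳ-sum (+ suc k) (λ a → Σnode (λ b → cartan a b * αα a b)) ⟨
  Σnode (λ a → Σnode (λ b → cartan a b * αα a b)) * + suc k
    ≡⟨ cong (_* + suc k) α-norm ⟩
  + 2 * + suc k ∎
  where
  open ≡-Reasoning
  αα : Node → Node → ℤ
  αα a b = + (αcoeff a ℕ.* αcoeff b)
  term : ∀ a b → cartan a b * + sum (map (λ r → Qmin (proj₁ r) (target (suc k) b)) (target (suc k) a))
               ≡ cartan a b * αα a b * + suc k
  term a b = begin
    cartan a b * + sum (map (λ r → Qmin (proj₁ r) (target (suc k) b)) (target (suc k) a))
      ≡⟨ cong (λ n → cartan a b * + n)
              (trans (sum-map-replicate (λ r → Qmin (proj₁ r) (target (suc k) b)) (αcoeff a) (suc k , + 0))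
                     (cong (αcoeff a ℕ.*_) (Qmin-target (suc k) b))) ⟩
    cartan a b * + (αcoeff a ℕ.* (αcoeff b ℕ.* suc k))
      ≡⟨ cong (λ n → cartan a b * + n) (ℕP.*-assoc (αcoeff a) (αcoeff b) (suc k)) ⟨
    cartan a b * + (αcoeff a ℕ.* αcoeff b ℕ.* suc k)
      ≡⟨ cong (cartan a b *_) (ℤP.pos-* (αcoeff a ℕ.* αcoeff b) (suc k)) ⟩
    cartan a b * (αα a b * + suc k)
      ≡⟨ ℤP.*-assoc (cartan a b) (αα a b) (+ suc k) ⟨
    cartan a b * αα a b * + suc k ∎
cocharge-target : ∀ k → cocharge (target k) ≡ + k
cocharge-target zero    = refl
cocharge-target (suc k) = begin
  quadTerm (target (suc k)) /ℕ 2 + rigSum (target (suc k)) ≡⟨ cong (λ q → q /ℕ 2 + + 0) (quadTerm-target k) ⟩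
  (+ 2 * + suc k) /ℕ 2 + + 0                             ≡⟨ ℤP.+-identityʳ _ ⟩
  + (2 ℕ.* suc k / 2)                                     ≡⟨ cong (λ n → + (n / 2)) (ℕP.*-comm 2 (suc k)) ⟩
  + (suc k ℕ.* 2 / 2)                                     ≡⟨ cong +_ (m*n/n≡m (suc k) 2) ⟩
  + suc k                                                 ∎
  where open ≡-Reasoning

proposition9p8 : (∀ b → αWeight b ≡ Λ5-Λ1 b)
    × ((s : ℕ) → 1 ≤ s →
      ((ν : RC) → IsHighestWeightRC n5 s ν ⇔ (∃[ k ] (k ≤ s × (∀ a → ν a ≡ target k a))))
      × ((k : ℕ) → k ≤ s →
          (∀ b → weight n5 s (target k) b ≡ hwWeight s k b)
          × cocharge (target k) ≡ + k))
proposition9p8 =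
  αWeight≡Λ5-Λ1 ,
  λ s _ →
    (λ ν → mk⇔ HighestWeight.classification (λ (k , k≤s , ν≡) → isHighestWeight-target k≤s ν≡)) ,
    (λ k k≤s → weight-target k≤s , cocharge-target k)
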